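{- Let $p$ be a prime and let $i$ be an integer with $1 \leq i \leq p - 2$. Then either $i \equiv -\frac{s}{r + s} \pmod{p}$ for some relatively prime integers $r, s$ with $0 < r, s < \sqrt{p}$, or $i \equiv \frac{s}{r - s} \pmod{p}$ for some relatively prime integers $r, s$ with $0 < r, s < \sqrt{p}$ which are not both $1$. Furthermore, there is at most one such pair $(r, s)$ with $i \equiv -\frac{s}{r + s} \pmod{p}$, and at most one such pair $(r,s)$ with $i \equiv \frac{s}{r - s} \pmod{p}$.
   Context: Fractions modulo $p$ denote multiplication by the modular inverse of the denominator, e.g. $i \equiv \frac{s}{r-s} \pmod p$ means $i(r-s) \equiv s \pmod p$ with $r-s \not\equiv 0 \pmod p$. -}

module Defs where

open import Data.Nat using (ℕ; _*_; _<_; _≤_)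
open import Data.Nat.Coprimality using (Coprime)
open import Data.Integer as ℤ using (ℤ; +_; -_; _-_)
open import Data.Integer.Divisibility as ℤDiv using ()
open import Data.Product using (_×_)
open import Relation.Binary.PropositionalEquality using (_≡_)
open import Relation.Nullary using (¬_)

infix 4 _≡_[mod_]
_≡_[mod_] : ℤ → ℤ → ℕ → Set
a ≡ b [mod p ] = (+ p) ℤDiv.∣ (a - b)

-- r, s relatively prime with 0 < r, s < √p   (for naturals, s < √p ⇔ s * s < p).
Admissible : ℕ → ℕ → ℕ → Set
Admissible p r s = (0 < r) × (0 < s) × (r * r < p) × (s * s < p) × Coprime r s

-- i ≡ - s / (r + s) (mod p):  i (r + s) ≡ - s (mod p), with r + s ≢ 0 (mod p).
MinusPair : ℕ → ℤ → ℕ → ℕ → Set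
MinusPair p i r s =
  Admissible p r s
  × (¬ (((+ r) ℤ.+ (+ s)) ≡ (+ 0) [mod p ]))
  × ((i ℤ.* ((+ r) ℤ.+ (+ s))) ≡ (- (+ s)) [mod p ])

-- i ≡ s / (r - s) (mod p):  i (r - s) ≡ s (mod p), with r - s ≢ 0 (mod p),
-- and r, s not both 1.
PlusPair : ℕ → ℤ → ℕ → ℕ → Set
PlusPair p i r s =
  Admissible p r s
  × (¬ (r ≡ 1 × s ≡ 1))
  × (¬ (((+ r) - (+ s)) ≡ (+ 0) [mod p ]))
  × ((i ℤ.* ((+ r) - (+ s))) ≡ (+ s) [mod p ])

-- Both congruences are of the form i r ≡ c s with c = ±(i + 1), a unit mod p.  Thue's
-- lemma (pigeonhole on i x − (i + 1) y for 0 ≤ x, y ≤ ⌊√p⌋) gives a solution of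
-- i x ≡ (i + 1) y with 0 < |x|, |y| < √p; the signs of x and y decide whether
-- (|x|, |y|) solves i r ≡ (i + 1) s or i r ≡ −(i + 1) s, and dividing out their gcd
-- (a unit, being below p) makes the pair coprime.  Two coprime solutions (r, s), (r′, s′)
-- of the same congruence satisfy r s′ ≡ r′ s (mod p), hence r s′ = r′ s as both sides are
-- below p, and coprimality forces (r, s) = (r′, s′).
module Submission where

open import Defs
open import Data.Nat using (ℕ; _+_; _≤_)
open import Data.Nat.Primality using (Prime)
open import Data.Integer using (+_)
open import Data.Product using (_×_; ∃₂)
open import Data.Sum using (_⊎_)
open import Relation.Binary.PropositionalEquality using (_≡_)

open import Level using (0ℓ)
open import Function using (_∘_; id)
open import Data.Nat as ℕ using (zero; suc; _<_; _/_; z<s; NonZero)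
import Data.Nat.Properties as ℕₚ
import Data.Nat.Divisibility as ℕᵈ
import Data.Nat.DivMod as ℕDM
open import Data.Nat.Coprimality as Coprime using (Coprime; coprime-divisor; coprime-/gcd)
open import Data.Nat.GCD using (gcd; gcd[m,n]∣m; gcd[m,n]∣n; gcd[m,n]≢0)
open import Data.Nat.Primality using (euclidsLemma; prime⇒irreducible; prime⇒nonTrivial; prime⇒nonZero)
open import Data.Integer as ℤ using (ℤ; -_; _-_; _*_; ∣_∣; -[1+_])
import Data.Integer.Properties as ℤₚ
import Data.Integer.Divisibility as ℤᵘ
import Data.Integer.Divisibility.Signed as ℤˢ
open import Data.Integer.DivMod using (_%ℕ_; _/ℕ_; n%ℕd<d; a≡a%ℕn+[a/ℕn]*n)
open import Data.Integer.Tactic.RingSolver using (solve-∀)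
open import Data.Fin as Fin using (Fin; toℕ; fromℕ<; remQuot; combine)
import Data.Fin.Properties as Finₚ
open import Data.Product using (_,_; proj₁; proj₂; ∃-syntax)
open import Data.Sum as Sum using (inj₁; inj₂)
open import Data.Empty using (⊥-elim)
open import Relation.Nullary using (¬_; yes; no)
open import Relation.Binary.Bundles using (Setoid)
open import Relation.Binary.Structures using (IsEquivalence)
open import Relation.Binary.PropositionalEquality
  using (_≢_; refl; sym; trans; cong; cong₂; subst; subst₂; module ≡-Reasoning)
import Relation.Binary.Reasoning.Setoid as SetoidReasoning

private
  variable
    a b c d : ℤ
    n p : ℕ

⌊√⌋-exists : ∀ n → ∃[ k ] k ℕ.* k ≤ n × n < suc k ℕ.* suc k
⌊√⌋-exists zero = 0 , ℕ.z≤n , z<s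
⌊√⌋-exists (suc n) with ⌊√⌋-exists n
... | k , k²≤n , n<[1+k]² with suc k ℕ.* suc k ℕ.≤? suc n
...   | yes [1+k]²≤1+n = suc k , [1+k]²≤1+n ,
                         ℕₚ.≤-<-trans n<[1+k]² (ℕₚ.*-mono-< (ℕₚ.n<1+n (suc k)) (ℕₚ.n<1+n (suc k)))
...   | no  [1+k]²≰1+n = k , ℕₚ.m≤n⇒m≤1+n k²≤n , ℕₚ.≰⇒> [1+k]²≰1+n

prime⇒¬square : Prime p → ∀ k → k ℕ.* k ≢ p
prime⇒¬square {p} pr k k²≡p = ℕₚ.<⇒≢ (ℕ.nonTrivial⇒n>1 p {{prime⇒nonTrivial pr}}) (sym p≡1)
  where
  p≡1 : p ≡ 1
  p≡1 with prime⇒irreducible pr (subst (k ℕᵈ.∣_) k²≡p (ℕᵈ.m∣m*n k))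
  ... | inj₁ refl = sym k²≡p
  ... | inj₂ refl = ℕₚ.*-cancelˡ-≡ p 1 p {{prime⇒nonZero pr}} (trans k²≡p (sym (ℕₚ.*-identityʳ p)))

prime⇒strict-⌊√⌋ : Prime p → ∃[ k ] k ℕ.* k < p × p < suc k ℕ.* suc k
prime⇒strict-⌊√⌋ {p} pr with ⌊√⌋-exists p
... | k , k²≤p , p<[1+k]² = k , ℕₚ.≤∧≢⇒< k²≤p (prime⇒¬square pr k) , p<[1+k]²

m*m<n⇒m<n : ∀ m {n} → m ℕ.* m < n → m < n
m*m<n⇒m<n zero    m²<n = m²<n
m*m<n⇒m<n (suc m) m²<n = ℕₚ.≤-<-trans (ℕₚ.m≤m*n (suc m) (suc m)) m²<n

m*m<n⇒o*o<n⇒m*o<n : ∀ m o {n} → m ℕ.* m < n → o ℕ.* o < n → m ℕ.* o < n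
m*m<n⇒o*o<n⇒m*o<n m o m²<n o²<n with ℕₚ.≤-total m o
... | inj₁ m≤o = ℕₚ.≤-<-trans (ℕₚ.*-monoˡ-≤ o m≤o) o²<n
... | inj₂ o≤m = ℕₚ.≤-<-trans (ℕₚ.*-monoʳ-≤ m o≤m) m²<n

coprime-cross-multiplication : ∀ {r s r′ s′} → Coprime r s → Coprime r′ s′ →
  r ℕ.* s′ ≡ r′ ℕ.* s → r ≡ r′ × s ≡ s′
coprime-cross-multiplication {r} {s} {r′} {s′} cop cop′ eq =
  ℕᵈ.∣-antisym (coprime-divisor cop r∣sr′) (coprime-divisor cop′ r′∣s′r) ,
  ℕᵈ.∣-antisym (coprime-divisor (Coprime.sym cop) s∣rs′) (coprime-divisor (Coprime.sym cop′) s′∣r′s)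
  where
  r∣sr′ : r ℕᵈ.∣ s ℕ.* r′
  r∣sr′ = subst (r ℕᵈ.∣_) (trans eq (ℕₚ.*-comm r′ s)) (ℕᵈ.m∣m*n s′)
  r′∣s′r : r′ ℕᵈ.∣ s′ ℕ.* r
  r′∣s′r = subst (r′ ℕᵈ.∣_) (trans (sym eq) (ℕₚ.*-comm r s′)) (ℕᵈ.m∣m*n s)
  s∣rs′ : s ℕᵈ.∣ r ℕ.* s′
  s∣rs′ = subst (s ℕᵈ.∣_) (sym eq) (ℕᵈ.n∣m*n r′)
  s′∣r′s : s′ ℕᵈ.∣ r′ ℕ.* s
  s′∣r′s = subst (s′ ℕᵈ.∣_) eq (ℕᵈ.n∣m*n r)

∣∧<⇒≡0 : ∀ {m} → n ℕᵈ.∣ m → m < n → m ≡ 0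
∣∧<⇒≡0 {m = zero}  _   _   = refl
∣∧<⇒≡0 {m = suc _} n∣m m<n = ⊥-elim (ℕᵈ.>⇒∤ m<n n∣m)

∣[+m]-[+n]∣< : ∀ {m n k} → m < k → n < k → ∣ + m - + n ∣ < k
∣[+m]-[+n]∣< {m} {n} m<k n<k rewrite ℤₚ.[+m]-[+n]≡m⊖n m n =
  ℕₚ.≤-<-trans (ℤₚ.∣m⊝n∣≤m⊔n m n) (ℕₚ.⊔-lub m<k n<k)

-- An opaque copy of _≡_[mod_]: the transparent relation unfolds to a statement about
-- a - b alone, so unification could never infer a and b.
opaque
  infix 4 _≈_[mod_]
  _≈_[mod_] : ℤ → ℤ → ℕ → Set
  a ≈ b [mod n ] = a ≡ b [mod n ]

  ≈⇒≡-mod : a ≈ b [mod n ] → a ≡ b [mod n ]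
  ≈⇒≡-mod h = h

  ≡-mod⇒≈ : a ≡ b [mod n ] → a ≈ b [mod n ]
  ≡-mod⇒≈ h = h

  private
    ≈⇒∣ : ∀ a b → a ≈ b [mod n ] → + n ℤˢ.∣ a - b
    ≈⇒∣ a b = ℤˢ.∣ᵤ⇒∣

    ∣⇒≈ : ∀ a b → + n ℤˢ.∣ a - b → a ≈ b [mod n ]
    ∣⇒≈ a b = ℤˢ.∣⇒∣ᵤ

  ≈-by-difference : a - b ≡ c - d → a ≈ b [mod n ] → c ≈ d [mod n ]
  ≈-by-difference {n = n} eq = subst (+ n ℤᵘ.∣_) eq

  ≈-reflexive : a ≡ b → a ≈ b [mod n ]
  ≈-reflexive {a} {n = n} refl =
    subst (n ℕᵈ.∣_) (cong ∣_∣ (sym (ℤₚ.+-inverseʳ a))) (n ℕᵈ.∣0)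

  ≈-sym : a ≈ b [mod n ] → b ≈ a [mod n ]
  ≈-sym {a} {b} h = ∣⇒≈ b a (subst (_ ℤˢ.∣_) (swap a b) (ℤˢ.∣m⇒∣-m (≈⇒∣ a b h)))
    where
    swap : ∀ a b → - (a - b) ≡ b - a
    swap = solve-∀

  ≈-trans : a ≈ b [mod n ] → b ≈ c [mod n ] → a ≈ c [mod n ]
  ≈-trans {a} {b} {c = c} h k = ∣⇒≈ a c (subst (_ ℤˢ.∣_) (ℤₚ.+-minus-telescope a b c)
    (ℤˢ.∣m∣n⇒∣m+n (≈⇒∣ a b h) (≈⇒∣ b c k)))

  ≈-*ˡ : ∀ c → a ≈ b [mod n ] → c * a ≈ c * b [mod n ]
  ≈-*ˡ {a} {b} c h = ∣⇒≈ (c * a) (c * b)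
    (subst (_ ℤˢ.∣_) (distrib c a b) (ℤˢ.∣n⇒∣m*n c (≈⇒∣ a b h)))
    where
    distrib : ∀ c a b → c * (a - b) ≡ c * a - c * b
    distrib = solve-∀

  ≈-neg : a ≈ b [mod n ] → - a ≈ - b [mod n ]
  ≈-neg {a} {b} h = ∣⇒≈ (- a) (- b) (subst (_ ℤˢ.∣_) (distrib a b) (ℤˢ.∣m⇒∣-m (≈⇒∣ a b h)))
    where
    distrib : ∀ a b → - (a - b) ≡ - a - - b
    distrib = solve-∀

  ≈0⇒∣ : a ≈ + 0 [mod n ] → n ℕᵈ.∣ ∣ a ∣
  ≈0⇒∣ {a} = subst (_ ℕᵈ.∣_) (cong ∣_∣ (ℤₚ.+-identityʳ a))

  ∣⇒≈0 : n ℕᵈ.∣ ∣ a ∣ → a ≈ + 0 [mod n ]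
  ∣⇒≈0 {a = a} = subst (_ ℕᵈ.∣_) (cong ∣_∣ (sym (ℤₚ.+-identityʳ a)))

≈-isEquivalence : IsEquivalence (_≈_[mod n ])
≈-isEquivalence = record { refl = ≈-reflexive refl ; sym = ≈-sym ; trans = ≈-trans }

≈-setoid : ℕ → Setoid 0ℓ 0ℓ
≈-setoid n = record { isEquivalence = ≈-isEquivalence {n} }

≈0⇒≡0 : ∣ a ∣ < n → a ≈ + 0 [mod n ] → a ≡ + 0
≈0⇒≡0 lt h = ℤₚ.∣i∣≡0⇒i≡0 (∣∧<⇒≡0 (≈0⇒∣ h) lt)

≈⇒≡ : ∣ a - b ∣ < n → a ≈ b [mod n ] → a ≡ b
≈⇒≡ {a} {b} lt h = ℤₚ.i-j≡0⇒i≡j a b (≈0⇒≡0 lt (≈-by-difference (sym (ℤₚ.+-identityʳ (a - b))) h))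

≉0 : ∀ {m} → 0 < m → m < n → ¬ + m ≈ + 0 [mod n ]
≉0 {m = suc _} _ m<n h = ℕᵈ.>⇒∤ m<n (≈0⇒∣ h)

≈0-* : Prime p → a * b ≈ + 0 [mod p ] → a ≈ + 0 [mod p ] ⊎ b ≈ + 0 [mod p ]
≈0-* {a = a} {b = b} pr h =
  Sum.map ∣⇒≈0 ∣⇒≈0 (euclidsLemma ∣ a ∣ ∣ b ∣ pr (subst (_ ℕᵈ.∣_) (ℤₚ.abs-* a b) (≈0⇒∣ h)))

≈-cancelˡ : Prime p → ¬ c ≈ + 0 [mod p ] → c * a ≈ c * b [mod p ] → a ≈ b [mod p ]
≈-cancelˡ {c = c} {a = a} {b = b} pr c≉0 h =
  Sum.[ ⊥-elim ∘ c≉0 , ≈-by-difference (ℤₚ.+-identityʳ (a - b)) ]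
    (≈0-* pr (≈-by-difference (factor c a b) h))
  where
  factor : ∀ c a b → c * a - c * b ≡ c * (a - b) - + 0
  factor = solve-∀

≈0-*ˡ : ∀ c → a ≈ + 0 [mod n ] → c * a ≈ + 0 [mod n ]
≈0-*ˡ {a} {n} c a≈0 = begin
  c * a    ≈⟨ ≈-*ˡ c a≈0 ⟩
  c * + 0  ≡⟨ ℤₚ.*-zeroʳ c ⟩
  + 0      ∎
  where open SetoidReasoning (≈-setoid n)

≈-%ℕ : .{{_ : NonZero n}} → ∀ z → z ≈ + (z %ℕ n) [mod n ]
≈-%ℕ {n} z = ≈-by-difference shift (∣⇒≈0 {a = q * + n} n∣qn)
  where
  q = z /ℕ n
  n∣qn : n ℕᵈ.∣ ∣ q * + n ∣
  n∣qn = subst (n ℕᵈ.∣_) (sym (ℤₚ.abs-* q (+ n))) (ℕᵈ.n∣m*n ∣ q ∣)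
  shift : q * + n - + 0 ≡ z - + (z %ℕ n)
  shift = begin
    q * + n - + 0                         ≡⟨ add-sub (+ (z %ℕ n)) (q * + n) ⟩
    (+ (z %ℕ n) ℤ.+ q * + n) - + (z %ℕ n) ≡⟨ cong (_- + (z %ℕ n)) (sym (a≡a%ℕn+[a/ℕn]*n z n)) ⟩
    z - + (z %ℕ n)                        ∎
    where
    open ≡-Reasoning
    add-sub : ∀ r x → x - + 0 ≡ (r ℤ.+ x) - r
    add-sub = solve-∀

thue : .{{_ : NonZero n}} → ∀ a b k → n < k ℕ.* k →
       ∃₂ λ x y → ∣ x ∣ < k × ∣ y ∣ < k × ¬ (x ≡ + 0 × y ≡ + 0) × a * x ≈ b * y [mod n ]
thue {n} a b k n<k² = from-collision (Finₚ.pigeonhole n<k² residue)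
  where
  value : Fin k × Fin k → ℤ
  value (x , y) = a * + toℕ x - b * + toℕ y

  residue : Fin (k ℕ.* k) → Fin n
  residue j = fromℕ< (n%ℕd<d (value (remQuot {k} k j)) n)

  regroup : ∀ a b x₁ y₁ x₂ y₂ →
    (a * x₁ - b * y₁) - (a * x₂ - b * y₂) ≡ a * (x₁ - x₂) - b * (y₁ - y₂)
  regroup = solve-∀

  coordinate : ∀ {u v : Fin k} → + toℕ u - + toℕ v ≡ + 0 → u ≡ v
  coordinate eq = Finₚ.toℕ-injective (ℤₚ.+-injective (ℤₚ.i-j≡0⇒i≡j _ _ eq))

  from-collision : ∃₂ (λ j₁ j₂ → j₁ Fin.< j₂ × residue j₁ ≡ residue j₂) →
    ∃₂ λ x y → ∣ x ∣ < k × ∣ y ∣ < k × ¬ (x ≡ + 0 × y ≡ + 0) × a * x ≈ b * y [mod n ]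
  from-collision (j₁ , j₂ , j₁<j₂ , same-residue) =
    + toℕ x₁ - + toℕ x₂ , + toℕ y₁ - + toℕ y₂ ,
    ∣[+m]-[+n]∣< (Finₚ.toℕ<n x₁) (Finₚ.toℕ<n x₂) , ∣[+m]-[+n]∣< (Finₚ.toℕ<n y₁) (Finₚ.toℕ<n y₂) ,
    distinct , ≈-by-difference (regroup a b (+ toℕ x₁) (+ toℕ y₁) (+ toℕ x₂) (+ toℕ y₂)) same-value
    where
    x₁ = proj₁ (remQuot {k} k j₁)
    y₁ = proj₂ (remQuot {k} k j₁)
    x₂ = proj₁ (remQuot {k} k j₂)
    y₂ = proj₂ (remQuot {k} k j₂)

    same-value : value (x₁ , y₁) ≈ value (x₂ , y₂) [mod n ]
    same-value = begin
      value (x₁ , y₁)              ≈⟨ ≈-%ℕ (value (x₁ , y₁)) ⟩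
      + (value (x₁ , y₁) %ℕ n)     ≡⟨ cong +_ (Finₚ.toℕ-fromℕ< _) ⟨
      + toℕ (residue j₁)           ≡⟨ cong (+_ ∘ toℕ) same-residue ⟩
      + toℕ (residue j₂)           ≡⟨ cong +_ (Finₚ.toℕ-fromℕ< _) ⟩
      + (value (x₂ , y₂) %ℕ n)     ≈⟨ ≈-%ℕ (value (x₂ , y₂)) ⟨
      value (x₂ , y₂)              ∎
      where open SetoidReasoning (≈-setoid n)

    distinct : ¬ (+ toℕ x₁ - + toℕ x₂ ≡ + 0 × + toℕ y₁ - + toℕ y₂ ≡ + 0)
    distinct (x-eq , y-eq) = ℕₚ.<⇒≢ j₁<j₂ (cong toℕ (begin
      j₁             ≡⟨ Finₚ.combine-remQuot {k} k j₁ ⟨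
      combine x₁ y₁  ≡⟨ cong₂ combine (coordinate x-eq) (coordinate y-eq) ⟩
      combine x₂ y₂  ≡⟨ Finₚ.combine-remQuot {k} k j₂ ⟩
      j₂             ∎))
      where open ≡-Reasoning

≈-abs-coordinates : ∀ a c x y → a * x ≈ c * y [mod n ] →
  a * + ∣ x ∣ ≈ c * + ∣ y ∣ [mod n ] ⊎ a * + ∣ x ∣ ≈ - c * + ∣ y ∣ [mod n ]
≈-abs-coordinates a c (+ _)      (+ _)      h = inj₁ h
≈-abs-coordinates a c (+ x)      -[1+ y ]   h = inj₂ (≈-by-difference (flip-right a c (+ x) (+ suc y)) h)
  where
  flip-right : ∀ a c x y → a * x - c * (- y) ≡ a * x - (- c) * y
  flip-right = solve-∀
≈-abs-coordinates a c -[1+ x ]   (+ y)      h = inj₂ (≈-by-difference (flip-left a c (+ suc x) (+ y)) (≈-neg h))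
  where
  flip-left : ∀ a c x y → - (a * (- x)) - - (c * y) ≡ a * x - (- c) * y
  flip-left = solve-∀
≈-abs-coordinates a c -[1+ x ]   -[1+ y ]   h = inj₁ (≈-by-difference (flip-both a c (+ suc x) (+ suc y)) (≈-neg h))
  where
  flip-both : ∀ a c x y → - (a * (- x)) - - (c * (- y)) ≡ a * x - c * y
  flip-both = solve-∀

nonzero-coordinates : Prime p → ¬ a ≈ + 0 [mod p ] → ¬ c ≈ + 0 [mod p ] → ∀ x y →
  ∣ x ∣ < p → ∣ y ∣ < p → ¬ (x ≡ + 0 × y ≡ + 0) → a * x ≈ c * y [mod p ] → 0 < ∣ x ∣ × 0 < ∣ y ∣
nonzero-coordinates {p} {a} {c} pr a≉0 c≉0 x y ∣x∣<p ∣y∣<p nonzero h =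
  positive (λ x≡0 → nonzero (x≡0 , vanishing c≉0 ∣y∣<p (begin
    c * y    ≈⟨ h ⟨
    a * x    ≡⟨ cong (a *_) x≡0 ⟩
    a * + 0  ≡⟨ ℤₚ.*-zeroʳ a ⟩
    + 0      ∎))) ,
  positive (λ y≡0 → nonzero (vanishing a≉0 ∣x∣<p (begin
    a * x    ≈⟨ h ⟩
    c * y    ≡⟨ cong (c *_) y≡0 ⟩
    c * + 0  ≡⟨ ℤₚ.*-zeroʳ c ⟩
    + 0      ∎) , y≡0))
  where
  open SetoidReasoning (≈-setoid p)

  vanishing : ∀ {u z} → ¬ u ≈ + 0 [mod p ] → ∣ z ∣ < p → u * z ≈ + 0 [mod p ] → z ≡ + 0
  vanishing u≉0 ∣z∣<p uz≈0 = ≈0⇒≡0 ∣z∣<p (Sum.[ ⊥-elim ∘ u≉0 , id ] (≈0-* pr uz≈0))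

  positive : ∀ {z} → z ≢ + 0 → 0 < ∣ z ∣
  positive z≢0 = ℕₚ.n≢0⇒n>0 (z≢0 ∘ ℤₚ.∣i∣≡0⇒i≡0)

coprime-reduction : Prime p → ∀ a b {r s} → 0 < r → 0 < s → r ℕ.* r < p → s ℕ.* s < p →
  a * + r ≈ b * + s [mod p ] → ∃₂ λ r′ s′ → Admissible p r′ s′ × a * + r′ ≈ b * + s′ [mod p ]
coprime-reduction {p} pr a b {r} {s} r>0 s>0 r²<p s²<p h =
  r / g , s / g ,
  (quotient>0 r>0 g∣r , quotient>0 s>0 g∣s , shrink r²<p , shrink s²<p , coprime-/gcd r s) ,
  ≈-cancelˡ pr (≉0 g>0 g<p) (≈-by-difference regroup h)
  where
  g = gcd r s
  g∣r = gcd[m,n]∣m r s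
  g∣s = gcd[m,n]∣n r s

  g>0 : 0 < g
  g>0 = ℕₚ.n≢0⇒n>0 (gcd[m,n]≢0 r s (inj₁ (ℕₚ.>⇒≢ r>0)))

  instance
    g≢0 : NonZero g
    g≢0 = ℕ.>-nonZero g>0

  g<p : g < p
  g<p = ℕₚ.≤-<-trans (ℕᵈ.∣⇒≤ {{ℕ.>-nonZero r>0}} g∣r)
                     (ℕₚ.≤-<-trans (ℕₚ.m≤m*n r r {{ℕ.>-nonZero r>0}}) r²<p)

  quotient>0 : ∀ {m} → 0 < m → g ℕᵈ.∣ m → 0 < m / g
  quotient>0 m>0 g∣m = ℕDM.m≥n⇒m/n>0 (ℕᵈ.∣⇒≤ {{ℕ.>-nonZero m>0}} g∣m)

  shrink : ∀ {m} → m ℕ.* m < p → (m / g) ℕ.* (m / g) < p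
  shrink {m} = ℕₚ.≤-<-trans (ℕₚ.*-mono-≤ (ℕDM.m/n≤m m g) (ℕDM.m/n≤m m g))

  split : ∀ {m} → g ℕᵈ.∣ m → + m ≡ + (m / g) * + g
  split {m} g∣m = trans (cong +_ (sym (ℕDM.m/n*n≡m g∣m))) (ℤₚ.pos-* (m / g) g)

  factor : ∀ a b x y g → a * (x * g) - b * (y * g) ≡ g * (a * x) - g * (b * y)
  factor = solve-∀

  regroup : a * + r - b * + s ≡ + g * (a * + (r / g)) - + g * (b * + (s / g))
  regroup = begin
    a * + r - b * + s
      ≡⟨ cong₂ (λ x y → a * x - b * y) (split g∣r) (split g∣s) ⟩
    a * (+ (r / g) * + g) - b * (+ (s / g) * + g)
      ≡⟨ factor a b (+ (r / g)) (+ (s / g)) (+ g) ⟩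
    + g * (a * + (r / g)) - + g * (b * + (s / g))
      ∎
    where open ≡-Reasoning

thue-admissible : Prime p → ¬ a ≈ + 0 [mod p ] → ¬ c ≈ + 0 [mod p ] →
  (∃₂ λ r s → Admissible p r s × a * + r ≈ c * + s [mod p ]) ⊎
  (∃₂ λ r s → Admissible p r s × a * + r ≈ - c * + s [mod p ])
thue-admissible {p} {a} {c} pr a≉0 c≉0 =
  let k , k²<p , p<[1+k]² = prime⇒strict-⌊√⌋ pr
      x , y , ∣x∣≤k , ∣y∣≤k , nonzero , h = thue {{prime⇒nonZero pr}} a c (suc k) p<[1+k]²
      small : ∀ {m} → m < suc k → m ℕ.* m < p
      small m≤k = ℕₚ.≤-<-trans (ℕₚ.*-mono-≤ (ℕ.s≤s⁻¹ m≤k) (ℕ.s≤s⁻¹ m≤k)) k²<p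
      ∣x∣>0 , ∣y∣>0 = nonzero-coordinates pr a≉0 c≉0 x y
        (m*m<n⇒m<n _ (small ∣x∣≤k)) (m*m<n⇒m<n _ (small ∣y∣≤k)) nonzero h
      reduce : ∀ d → a * + ∣ x ∣ ≈ d * + ∣ y ∣ [mod p ] →
               ∃₂ λ r s → Admissible p r s × a * + r ≈ d * + s [mod p ]
      reduce d = coprime-reduction pr a d ∣x∣>0 ∣y∣>0 (small ∣x∣≤k) (small ∣y∣≤k)
  in Sum.map (reduce c) (reduce (- c)) (≈-abs-coordinates a c x y h)

ratio-unique : Prime p → ∀ a c → ¬ a ≈ + 0 [mod p ] → ∀ {r s r′ s′} →
  Admissible p r s → Admissible p r′ s′ →
  a * + r ≈ c * + s [mod p ] → a * + r′ ≈ c * + s′ [mod p ] → r ≡ r′ × s ≡ s′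
ratio-unique {p} pr a c a≉0 {r} {s} {r′} {s′}
             (_ , _ , r²<p , s²<p , cop) (_ , _ , r′²<p , s′²<p , cop′) h h′ =
  coprime-cross-multiplication cop cop′ (ℤₚ.+-injective (≈⇒≡ small cross))
  where
  small : ∣ + (r ℕ.* s′) - + (r′ ℕ.* s) ∣ < p
  small = ∣[+m]-[+n]∣< (m*m<n⇒o*o<n⇒m*o<n r s′ r²<p s′²<p) (m*m<n⇒o*o<n⇒m*o<n r′ s r′²<p s²<p)

  rotate : ∀ a x y → a * (x * y) ≡ y * (a * x)
  rotate = solve-∀

  swap : ∀ x c y → x * (c * y) ≡ y * (c * x)
  swap = solve-∀

  shuffle : ∀ x y → a * + (x ℕ.* y) ≡ + y * (a * + x)
  shuffle x y = trans (cong (a *_) (ℤₚ.pos-* x y)) (rotate a (+ x) (+ y))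

  cross : + (r ℕ.* s′) ≈ + (r′ ℕ.* s) [mod p ]
  cross = ≈-cancelˡ pr a≉0 (begin
    a * + (r ℕ.* s′)   ≡⟨ shuffle r s′ ⟩
    + s′ * (a * + r)   ≈⟨ ≈-*ˡ (+ s′) h ⟩
    + s′ * (c * + s)   ≡⟨ swap (+ s′) c (+ s) ⟩
    + s * (c * + s′)   ≈⟨ ≈-*ˡ (+ s) h′ ⟨
    + s * (a * + r′)   ≡⟨ shuffle r′ s ⟨
    a * + (r′ ℕ.* s)   ∎)
    where open SetoidReasoning (≈-setoid p)

admissible⇒≉0 : ∀ {r s} → Admissible p r s → ¬ + s ≈ + 0 [mod p ]
admissible⇒≉0 {s = s} (_ , s>0 , _ , s²<p , _) = ≉0 s>0 (m*m<n⇒m<n s s²<p)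

admissible⇒1<p : ∀ {r s} → Admissible p r s → 1 < p
admissible⇒1<p (_ , s>0 , _ , s²<p , _) = ℕₚ.≤-<-trans (ℕₚ.*-mono-≤ s>0 s>0) s²<p

plus-shape : ∀ i r s → i * (r - s) - s ≡ i * r - (+ 1 ℤ.+ i) * s
plus-shape = solve-∀

minus-shape : ∀ i r s → i * (r ℤ.+ s) - - s ≡ i * r - - (+ 1 ℤ.+ i) * s
minus-shape = solve-∀

plusPair⇒≈ : ∀ i {r s} → PlusPair p i r s → i * + r ≈ (+ 1 ℤ.+ i) * + s [mod p ]
plusPair⇒≈ i {r} {s} (_ , _ , _ , h) =
  ≈-by-difference (plus-shape i (+ r) (+ s)) (≡-mod⇒≈ {a = i * (+ r - + s)} h)

minusPair⇒≈ : ∀ i {r s} → MinusPair p i r s → i * + r ≈ - (+ 1 ℤ.+ i) * + s [mod p ]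
minusPair⇒≈ i {r} {s} (_ , _ , h) =
  ≈-by-difference (minus-shape i (+ r) (+ s)) (≡-mod⇒≈ {a = i * (+ r ℤ.+ + s)} h)

≈⇒plusPair : ∀ i {r s} → Admissible p r s →
  i * + r ≈ (+ 1 ℤ.+ i) * + s [mod p ] → PlusPair p i r s
≈⇒plusPair {p} i {r} {s} adm h = adm , not-both-one , r-s≉0 , ≈⇒≡-mod h′
  where
  open SetoidReasoning (≈-setoid p)
  h′ : i * (+ r - + s) ≈ + s [mod p ]
  h′ = ≈-by-difference (sym (plus-shape i (+ r) (+ s))) h

  r-s≉0 : ¬ (+ r - + s ≡ + 0 [mod p ])
  r-s≉0 r-s≡0 = admissible⇒≉0 adm (begin
    + s              ≈⟨ h′ ⟨
    i * (+ r - + s)  ≈⟨ ≈0-*ˡ i (≡-mod⇒≈ {a = + r - + s} r-s≡0) ⟩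
    + 0              ∎)

  one-one : ¬ i * + 1 ≈ (+ 1 ℤ.+ i) * + 1 [mod p ]
  one-one h₁ = ≉0 z<s (admissible⇒1<p adm) (≈-by-difference (unit-gap i) (≈-sym h₁))
    where
    unit-gap : ∀ i → (+ 1 ℤ.+ i) * + 1 - i * + 1 ≡ + 1 - + 0
    unit-gap = solve-∀

  not-both-one : ¬ (r ≡ 1 × s ≡ 1)
  not-both-one (r≡1 , s≡1) =
    one-one (subst₂ (λ u v → i * + u ≈ (+ 1 ℤ.+ i) * + v [mod p ]) r≡1 s≡1 h)

≈⇒minusPair : ∀ i {r s} → Admissible p r s →
  i * + r ≈ - (+ 1 ℤ.+ i) * + s [mod p ] → MinusPair p i r s
≈⇒minusPair {p} i {r} {s} adm h = adm , r+s≉0 , ≈⇒≡-mod h′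
  where
  open SetoidReasoning (≈-setoid p)
  h′ : i * (+ r ℤ.+ + s) ≈ - + s [mod p ]
  h′ = ≈-by-difference (sym (minus-shape i (+ r) (+ s))) h

  r+s≉0 : ¬ (+ r ℤ.+ + s ≡ + 0 [mod p ])
  r+s≉0 r+s≡0 = admissible⇒≉0 adm (begin
    + s                  ≡⟨ ℤₚ.neg-involutive (+ s) ⟨
    - - + s              ≈⟨ ≈-neg (begin
      - + s                ≈⟨ h′ ⟨
      i * (+ r ℤ.+ + s)    ≈⟨ ≈0-*ˡ i (≡-mod⇒≈ {a = + r ℤ.+ + s} r+s≡0) ⟩
      + 0                  ∎) ⟩
    - + 0                ∎)

lemma2p6 : (p : ℕ) → Prime p → (i : ℕ) → 1 ≤ i → i + 2 ≤ p →
    ((∃₂ λ r s → MinusPair p (+ i) r s) ⊎ (∃₂ λ r s → PlusPair p (+ i) r s))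
    × (∀ r s r′ s′ → MinusPair p (+ i) r s → MinusPair p (+ i) r′ s′ → r ≡ r′ × s ≡ s′)
    × (∀ r s r′ s′ → PlusPair p (+ i) r s → PlusPair p (+ i) r′ s′ → r ≡ r′ × s ≡ s′)
lemma2p6 p pr i 1≤i i+2≤p =
  Sum.swap (Sum.map (pack (≈⇒plusPair I)) (pack (≈⇒minusPair I)) (thue-admissible pr i≉0 1+i≉0)) ,
  (λ _ _ _ _ m m′ → ratio-unique pr I (- (+ 1 ℤ.+ I)) i≉0 (proj₁ m) (proj₁ m′)
                      (minusPair⇒≈ I m) (minusPair⇒≈ I m′)) ,
  (λ _ _ _ _ m m′ → ratio-unique pr I (+ 1 ℤ.+ I) i≉0 (proj₁ m) (proj₁ m′)
                      (plusPair⇒≈ I m) (plusPair⇒≈ I m′))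
  where
  I = + i

  1+i<p : suc i < p
  1+i<p = subst (_≤ p) (ℕₚ.+-comm i 2) i+2≤p

  i≉0 : ¬ + i ≈ + 0 [mod p ]
  i≉0 = ≉0 1≤i (ℕₚ.<-trans (ℕₚ.n<1+n i) 1+i<p)

  1+i≉0 : ¬ + suc i ≈ + 0 [mod p ]
  1+i≉0 = ≉0 z<s 1+i<p

  pack : ∀ {Q Pair : ℕ → ℕ → Set} → (∀ {r s} → Admissible p r s → Q r s → Pair r s) →
    (∃₂ λ r s → Admissible p r s × Q r s) → ∃₂ Pair
  pack build (r , s , adm , h) = r , s , build adm h
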